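{- Let $n$ be a positive integer, $U_n=\{(\lambda,s,t): |\lambda|=n,\ 1\le s\le D(\lambda),\ 1\le t\le\lambda_1\}$, $Q_n\subseteq U_n$ the set of doubly marked partitions of $n$, and $$W_n=\{(\mu,a,b)\in U_n:\ \mu'_b>s(\mu')\text{ whenever }a=1\}.$$ Then the map $\tau$ defined below is a bijection from $U_n\setminus Q_n$ onto $W_n$.
   Context: Partitions are written with weakly decreasing positive parts $\lambda=(\lambda_1,\dots,\lambda_\ell)$; $\lambda'$ is the conjugate (so $\lambda'_s$ is the number of parts $\ge s$), $D(\lambda)$ is the side length of the Durfee square, and $s(\lambda)$ is the smallest part. A doubly marked partition of $n$ is a triple $(\lambda,s,t)$ with $|\lambda|=n$, $1\le s\le D(\lambda)$, $s\le t\le\lambda_1$, $\lambda'_s=\lambda'_t$. Thus $(\lambda,s,t)\in U_n\setminus Q_n$ means $1\le s\le D(\lambda)$, $1\le t\le\lambda_1$, and either $t<s$ or $\lambda'_s>\lambda'_t$. The map $\tau$ on $U_n\setminus Q_n$: let $p$ be the maximum integer with $\lambda'_p=\lambda'_s$. Define $$\delta=(\lambda_1-p+s-1,\ \dots,\ \lambda_{\lambda'_s}-p+s-1,\ \lambda_{\lambda'_s+1},\ \dots,\ \lambda_\ell)$$ (discarding zero parts, and with $\delta_i=0$ beyond its length). Let $a$ be the minimum integer such that $\delta_a<\lambda'_s$, and let $$\mu=(\delta_1,\dots,\delta_{a-1},\lambda'_s,\lambda'_{s+1},\dots,\lambda'_p,\delta_a,\delta_{a+1},\dots),$$ i.e.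 $\mu$ is obtained from $\delta$ by inserting $p-s+1$ parts equal to $\lambda'_s$. If $t<s$ set $b=t$; if $\lambda'_s>\lambda'_t$ set $b=t-p+s-1$. Then $\tau(\lambda,s,t)=(\mu,a,b)$. -}

module Defs where

open import Data.Nat using (ℕ; zero; suc; _+_; _∸_; _≤_; _<_; _⊓_; _≤ᵇ_; _<ᵇ_; _≡ᵇ_)
open import Data.Bool using (Bool; true; false; if_then_else_)
open import Data.List using (List; []; _∷_; length; filter; map; take; drop; _++_; applyUpTo; replicate)
open import Data.List.Relation.Unary.All using (All)
open import Data.List.Relation.Unary.Linked using (Linked)
open import Data.Product using (_×_; Σ; _,_)
open import Relation.Nullary using (¬_)
open import Relation.Binary.PropositionalEquality using (_≡_)
open import Data.Nat using (_≤?_)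
open import Data.Nat.ListAction using (sum)

IsPartition : ℕ → List ℕ → Set
IsPartition n λs = Linked (λ x y → y ≤ x) λs × All (λ x → 1 ≤ x) λs × sum λs ≡ n

-- i-th part (1-based); 0 beyond the length (and for index 0).
part : List ℕ → ℕ → ℕ
part [] _ = 0
part (x ∷ xs) zero = 0
part (x ∷ xs) (suc zero) = x
part (x ∷ xs) (suc (suc i)) = part xs (suc i)

largest : List ℕ → ℕ
largest λs = part λs 1

conj : List ℕ → ℕ → ℕ
conj λs s = length (filter (λ x → s ≤? x) λs)

conjList : List ℕ → List ℕ
conjList λs = applyUpTo (λ i → conj λs (suc i)) (largest λs)

-- smallest part s(λ) (0 for the empty partition)
smallest : List ℕ → ℕ
smallest [] = 0
smallest (x ∷ []) = x
smallest (x ∷ y ∷ r) = x ⊓ smallest (y ∷ r)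

maxWith : (ℕ → Bool) → ℕ → ℕ
maxWith P zero = 0
maxWith P (suc N) = if P (suc N) then suc N else maxWith P N

-- smallest i ∈ {k+1, …, k+N} with P i, or k+N+1 if none
minFrom : (ℕ → Bool) → ℕ → ℕ → ℕ
minFrom P k zero = suc k
minFrom P k (suc N) = if P (suc k) then suc k else minFrom P (suc k) N

durfee : List ℕ → ℕ
durfee λs = maxWith (λ i → i ≤ᵇ part λs i) (length λs)

Triple : Set
Triple = List ℕ × ℕ × ℕ

U : ℕ → Triple → Set
U n (λs , s , t) = IsPartition n λs × 1 ≤ s × s ≤ durfee λs × 1 ≤ t × t ≤ largest λs

Q : ℕ → Triple → Set
Q n (λs , s , t) = U n (λs , s , t) × s ≤ t × conj λs s ≡ conj λs t

UminusQ : ℕ → Triple → Set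
UminusQ n x = U n x × ¬ Q n x

W : ℕ → Triple → Set
W n (μ , a , b) = U n (μ , a , b) × (a ≡ 1 → smallest (conjList μ) < conj μ b)

tau : Triple → Triple
tau (λs , s , t) = (μ , a , b)
  where
  c : ℕ
  c = conj λs s
  -- p : maximum integer with λ'_p = λ'_s (searched in 1..λ₁; λ'_p = 0 beyond)
  p : ℕ
  p = maxWith (λ q → conj λs q ≡ᵇ c) (largest λs)
  k : ℕ
  k = p ∸ s + 1
  δ : List ℕ
  δ = filter (λ x → 1 ≤? x) (map (λ x → x ∸ k) (take c λs) ++ drop c λs)
  -- a : minimum integer with δ_a < λ'_s (δ_i = 0 beyond its length)
  a : ℕ
  a = minFrom (λ i → part δ i <ᵇ c) 0 (length δ)
  μ : List ℕ
  μ = take (a ∸ 1) δ ++ applyUpTo (λ i → conj λs (s + i)) k ++ drop (a ∸ 1) δ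
  b : ℕ
  b = if t <ᵇ s then t else t ∸ k

module Submission where

-- Write c = λ'_s and let p be the last column of height c.  Since λ'_p = c,
-- the c largest parts are all ≥ p, so τ first shaves k = p − s + 1 off each
-- of them (giving δ) and then inserts the k removed columns, now as k parts
-- equal to c, at the first position a where δ drops below c.  The inverse σ
-- reads c = μ_a and the length k of the run of parts equal to c starting at
-- a, removes the run and widens the c largest remaining parts by k; s and t
-- are recovered as δ_c + 1 and as b or b + k.
--
-- Lists are handled through their 0-based entries nth λ i = λ_{i+1}: lists
-- of positive parts are equal iff their entries are (positive-ext), and
-- conjugates are controlled by the Galois connection i < λ'_s ⇔ s ≤ λ_{i+1}.  The
-- theorem follows: injectivity from σ ∘ τ = id, surjectivity from τ ∘ σ = id.

open import Defs
open import Data.Nat using (ℕ; _≤_)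
open import Data.Product using (_×_; Σ; _,_)
open import Relation.Binary.PropositionalEquality using (_≡_)
open import Data.Nat hiding (_≤_)
open import Data.Nat.Properties
open import Data.Nat.ListAction using (sum)
open import Data.Nat.ListAction.Properties using (sum-++)
open import Data.Bool using (Bool; true; false; T; if_then_else_)
open import Data.Unit using (tt)
open import Data.List using (List; []; _∷_; length; filter; map; take; drop; _++_; applyUpTo; replicate)
open import Data.List.Properties
  using (filter-accept; filter-reject; length-applyUpTo; length-take; length-replicate; length-++; length-map; take++drop≡id)
open import Data.List.Relation.Unary.All using (All; []; _∷_)
open import Data.List.Relation.Unary.All.Properties using (++⁺; take⁺; drop⁺; replicate⁺; all-filter; applyUpTo⁺₁)
open import Data.List.Relation.Unary.Linked as Linked using (Linked; []; [-]; _∷_)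
open import Data.List.Relation.Unary.Linked.Properties using (map⁺; applyUpTo⁺₂; filter⁺)
open import Data.Product using (proj₁; proj₂)
open import Data.Sum using (_⊎_; inj₁; inj₂)
open import Data.Empty using (⊥; ⊥-elim)
open import Relation.Nullary using (¬_; yes; no)
open import Relation.Binary.Definitions using (tri<; tri≈; tri>)
open import Relation.Binary.PropositionalEquality hiding (_≡_)
open import Algebra.Properties.CommutativeSemigroup +-commutativeSemigroup using (interchange; xy∙z≈xz∙y; x∙yz≈xz∙y)

-- nth l i is the part λ_{i+1} (0-based indexing), and 0 past the end.
nth : List ℕ → ℕ → ℕ
nth l i = part l (suc i)

Decreasing : List ℕ → Set
Decreasing = Linked (λ x y → y ≤ x)

Positive : List ℕ → Set
Positive = All (1 ≤_)

below-or-beyond : ∀ m i → i < m ⊎ Σ ℕ (λ j → i ≡ m + j)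
below-or-beyond zero i = inj₂ (i , refl)
below-or-beyond (suc m) zero = inj₁ z<s
below-or-beyond (suc m) (suc i) with below-or-beyond m i
... | inj₁ i<m = inj₁ (s≤s i<m)
... | inj₂ (j , i≡m+j) = inj₂ (j , cong suc i≡m+j)

nth-beyond : ∀ l i → length l ≤ i → nth l i ≡ 0
nth-beyond [] i _ = refl
nth-beyond (x ∷ l) (suc i) (s≤s h) = nth-beyond l i h

nth-inside : ∀ l i → 1 ≤ nth l i → i < length l
nth-inside l i h with i <? length l
... | yes i<len = i<len
... | no i≮len = ⊥-elim (<-irrefl (sym (nth-beyond l i (≮⇒≥ i≮len))) h)

-- Lists of positive parts are determined by their entries; this is how
-- all list identities below are proved.
positive-ext : ∀ {l m} → Positive l → Positive m → (∀ i → nth l i ≡ nth m i) → l ≡ m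
positive-ext [] [] h = refl
positive-ext [] (py ∷ _) h = ⊥-elim (<-irrefl (h 0) py)
positive-ext (px ∷ _) [] h = ⊥-elim (<-irrefl (sym (h 0)) px)
positive-ext (_ ∷ pl) (_ ∷ pm) h = cong₂ _∷_ (h 0) (positive-ext pl pm (λ i → h (suc i)))

nth-++ˡ : ∀ xs ys i → i < length xs → nth (xs ++ ys) i ≡ nth xs i
nth-++ˡ (x ∷ xs) ys zero h = refl
nth-++ˡ (x ∷ xs) ys (suc i) (s≤s h) = nth-++ˡ xs ys i h

nth-++ʳ : ∀ xs ys j → nth (xs ++ ys) (length xs + j) ≡ nth ys j
nth-++ʳ [] ys j = refl
nth-++ʳ (x ∷ xs) ys j = nth-++ʳ xs ys j

nth-take : ∀ m l i → i < m → nth (take m l) i ≡ nth l i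
nth-take (suc m) [] i h = refl
nth-take (suc m) (x ∷ l) zero h = refl
nth-take (suc m) (x ∷ l) (suc i) (s≤s h) = nth-take m l i h

nth-drop : ∀ m l j → nth (drop m l) j ≡ nth l (m + j)
nth-drop zero l j = refl
nth-drop (suc m) [] j = refl
nth-drop (suc m) (x ∷ l) j = nth-drop m l j

nth-map-∸ : ∀ k l i → nth (map (_∸ k) l) i ≡ nth l i ∸ k
nth-map-∸ k [] i = sym (0∸n≡0 k)
nth-map-∸ k (x ∷ l) zero = refl
nth-map-∸ k (x ∷ l) (suc i) = nth-map-∸ k l i

nth-replicate : ∀ k c i → i < k → nth (replicate k c) i ≡ c
nth-replicate (suc k) c zero h = refl
nth-replicate (suc k) c (suc i) (s≤s h) = nth-replicate k c i h

nth-applyUpTo : ∀ f n i → i < n → nth (applyUpTo f n) i ≡ f i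
nth-applyUpTo f (suc n) zero h = refl
nth-applyUpTo f (suc n) (suc i) (s≤s h) = nth-applyUpTo (λ j → f (suc j)) n i h

suc-∸1 : ∀ {n} → 1 ≤ n → suc (n ∸ 1) ≡ n
suc-∸1 (s≤s _) = refl

length-take-≤ : ∀ m (l : List ℕ) → m ≤ length l → length (take m l) ≡ m
length-take-≤ m l h = trans (length-take m l) (m≤n⇒m⊓n≡m h)

decreasing-tail : ∀ {x l} → Decreasing (x ∷ l) → Decreasing l
decreasing-tail [-] = []
decreasing-tail (_ ∷ d) = d

decreasing-step : ∀ {l} → Decreasing l → ∀ i → nth l (suc i) ≤ nth l i
decreasing-step [] i = z≤n
decreasing-step [-] i = z≤n
decreasing-step (r ∷ d) zero = r
decreasing-step (r ∷ d) (suc i) = decreasing-step d i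

decreasing-mono : ∀ {l} → Decreasing l → ∀ {i j} → i ≤ j → nth l j ≤ nth l i
decreasing-mono d {i} {j} i≤j with ≤⇒≤′ i≤j
... | ≤′-refl = ≤-refl
... | ≤′-step {n} i≤n = ≤-trans (decreasing-step d n) (decreasing-mono d (≤′⇒≤ i≤n))

decreasing-++ : ∀ xs ys → Decreasing xs → Decreasing ys →
  (∀ i → i < length xs → nth ys 0 ≤ nth xs i) → Decreasing (xs ++ ys)
decreasing-++ [] ys dx dy h = dy
decreasing-++ (x ∷ []) [] dx dy h = [-]
decreasing-++ (x ∷ []) (y ∷ ys) dx dy h = h 0 z<s ∷ dy
decreasing-++ (x ∷ x' ∷ xs) ys (r ∷ dx) dy h =
  r ∷ decreasing-++ (x' ∷ xs) ys dx dy (λ i q → h (suc i) (s≤s q))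

decreasing-take : ∀ m l → Decreasing l → Decreasing (take m l)
decreasing-take zero l d = []
decreasing-take (suc m) [] d = []
decreasing-take (suc zero) (x ∷ l) d = [-]
decreasing-take (suc (suc m)) (x ∷ []) d = [-]
decreasing-take (suc (suc m)) (x ∷ y ∷ l) (r ∷ d) = r ∷ decreasing-take (suc m) (y ∷ l) d

decreasing-drop : ∀ m l → Decreasing l → Decreasing (drop m l)
decreasing-drop zero l d = d
decreasing-drop (suc m) [] d = []
decreasing-drop (suc m) (x ∷ l) d = decreasing-drop m l (decreasing-tail d)

decreasing-replicate : ∀ k c → Decreasing (replicate k c)
decreasing-replicate zero c = []
decreasing-replicate (suc zero) c = [-]
decreasing-replicate (suc (suc k)) c = ≤-refl ∷ decreasing-replicate (suc k) c

conj-cons-≤ : ∀ {s x} l → s ≤ x → conj (x ∷ l) s ≡ suc (conj l s)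
conj-cons-≤ {s} {x} l h = cong length (filter-accept (s ≤?_) {x} {l} h)

conj-cons-≰ : ∀ {s x} l → ¬ s ≤ x → conj (x ∷ l) s ≡ conj l s
conj-cons-≰ {s} {x} l h = cong length (filter-reject (s ≤?_) {x} {l} h)

conj-antitone : ∀ l {s s'} → s ≤ s' → conj l s' ≤ conj l s
conj-antitone [] h = z≤n
conj-antitone (x ∷ l) {s} {s'} h with s' ≤? x | s ≤? x
... | yes s'≤x | _ rewrite conj-cons-≤ l s'≤x | conj-cons-≤ l (≤-trans h s'≤x) = s≤s (conj-antitone l h)
... | no s'≰x | yes s≤x rewrite conj-cons-≰ l s'≰x | conj-cons-≤ l s≤x = m≤n⇒m≤1+n (conj-antitone l h)
... | no s'≰x | no s≰x rewrite conj-cons-≰ l s'≰x | conj-cons-≰ l s≰x = conj-antitone l h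

-- For a decreasing list, λ'_s counts an initial segment: the Galois
-- connection  i < λ'_s ⇔ s ≤ λ_{i+1}  (for s ≥ 1).
conj-galois⇒ : ∀ {l} → Decreasing l → ∀ {s i} → 1 ≤ s → i < conj l s → s ≤ nth l i
conj-galois⇒ {[]} d s1 ()
conj-galois⇒ {x ∷ l} d {s} {i} s1 h with s ≤? x
conj-galois⇒ {x ∷ l} d {s} {zero} s1 h | yes s≤x = s≤x
conj-galois⇒ {x ∷ l} d {s} {suc i} s1 h | yes s≤x =
  conj-galois⇒ (decreasing-tail d) s1 (s≤s⁻¹ (subst (suc i <_) (conj-cons-≤ l s≤x) h))
... | no s≰x = ⊥-elim (s≰x (≤-trans s≤tail (≤-trans (decreasing-mono (decreasing-tail d) z≤n) (decreasing-step d 0))))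
  where
  s≤tail : s ≤ nth l i
  s≤tail = conj-galois⇒ (decreasing-tail d) s1 (subst (i <_) (conj-cons-≰ l s≰x) h)

conj-galois⇐ : ∀ {l} → Decreasing l → ∀ {s i} → 1 ≤ s → s ≤ nth l i → i < conj l s
conj-galois⇐ {[]} d s1 h = ⊥-elim (<-irrefl refl (≤-trans s1 h))
conj-galois⇐ {x ∷ l} d {s} {i} s1 h with s ≤? x
conj-galois⇐ {x ∷ l} d {s} {zero} s1 h | yes s≤x rewrite conj-cons-≤ l s≤x = z<s
conj-galois⇐ {x ∷ l} d {s} {suc i} s1 h | yes s≤x rewrite conj-cons-≤ l s≤x =
  s≤s (conj-galois⇐ (decreasing-tail d) s1 h)
... | no s≰x = ⊥-elim (s≰x (≤-trans h (decreasing-mono d {0} {i} z≤n)))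

conj-exactly : ∀ {l} → Decreasing l → ∀ {s} X → 1 ≤ s →
  (∀ i → i < X → s ≤ nth l i) → (∀ i → s ≤ nth l i → i < X) → conj l s ≡ X
conj-exactly {l} d {s} X s1 below only-below with <-cmp (conj l s) X
... | tri< lt _ _ = ⊥-elim (<-irrefl refl (conj-galois⇐ d s1 (below (conj l s) lt)))
... | tri≈ _ eq _ = eq
... | tri> _ _ gt = ⊥-elim (<-irrefl refl (only-below X (conj-galois⇒ d s1 gt)))

-- Removing the zero parts of a decreasing list does not change its
-- entries (the zeros can only sit at the end).
nth-drop-zeros : ∀ l → Decreasing l → ∀ i → nth (filter (1 ≤?_) l) i ≡ nth l i
nth-drop-zeros [] d i = refl
nth-drop-zeros (x ∷ l) d i with 1 ≤? x
nth-drop-zeros (x ∷ l) d zero | yes 1≤x rewrite filter-accept (1 ≤?_) {x} {l} 1≤x = refl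
nth-drop-zeros (x ∷ l) d (suc i) | yes 1≤x rewrite filter-accept (1 ≤?_) {x} {l} 1≤x =
  nth-drop-zeros l (decreasing-tail d) i
... | no 1≰x rewrite filter-reject (1 ≤?_) {x} {l} 1≰x =
  trans (nth-drop-zeros l (decreasing-tail d) i) (trans tail-zero (sym all-zero))
  where
  x≤0 : x ≤ 0
  x≤0 = ≤-pred (≰⇒> 1≰x)
  all-zero : nth (x ∷ l) i ≡ 0
  all-zero = n≤0⇒n≡0 (≤-trans (decreasing-mono d {0} {i} z≤n) x≤0)
  tail-zero : nth l i ≡ 0
  tail-zero = n≤0⇒n≡0 (≤-trans (decreasing-mono d {0} {suc i} z≤n) x≤0)

sum-replicate : ∀ k c → sum (replicate k c) ≡ k * c
sum-replicate zero c = refl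
sum-replicate (suc k) c = cong (c +_) (sum-replicate k c)

-- Splitting a list after its first c entries (padding with zeros).
sum-split-at : ∀ c l → sum (applyUpTo (nth l) c) + sum (drop c l) ≡ sum l
sum-split-at zero l = refl
sum-split-at (suc c) [] = trans (+-identityʳ _) (zeros c)
  where
  zeros : ∀ c → sum (applyUpTo (nth []) (suc c)) ≡ 0
  zeros zero = refl
  zeros (suc c) = zeros c
sum-split-at (suc c) (x ∷ l) = trans (+-assoc x _ _) (cong (x +_) (sum-split-at c l))

sum-applyUpTo-+ : ∀ (g : ℕ → ℕ) k c → sum (applyUpTo (λ i → g i + k) c) ≡ sum (applyUpTo g c) + c * k
sum-applyUpTo-+ g k zero = refl
sum-applyUpTo-+ g k (suc c) = begin
  g 0 + k + sum (applyUpTo (λ i → g (suc i) + k) c)  ≡⟨ cong (g 0 + k +_) (sum-applyUpTo-+ (λ i → g (suc i)) k c) ⟩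
  g 0 + k + (sum (applyUpTo (λ i → g (suc i)) c) + c * k) ≡⟨ interchange (g 0) k _ (c * k) ⟩
  g 0 + sum (applyUpTo (λ i → g (suc i)) c) + (k + c * k) ∎
  where open ≡-Reasoning

-- widen c k δ adds k to each of the first c parts of δ (the inverse of
-- the first half of τ, which shaves k off the c largest parts).
widen : ℕ → ℕ → List ℕ → List ℕ
widen c k δ = applyUpTo (λ i → nth δ i + k) c ++ drop c δ

module _ (c k : ℕ) (δ : List ℕ) where

  private
    head : List ℕ
    head = applyUpTo (λ i → nth δ i + k) c

  nth-widen-head : ∀ i → i < c → nth (widen c k δ) i ≡ nth δ i + k
  nth-widen-head i i<c = trans (nth-++ˡ head (drop c δ) i (subst (i <_) (sym (length-applyUpTo _ c)) i<c))
                               (nth-applyUpTo _ c i i<c)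

  nth-widen-tail : ∀ j → nth (widen c k δ) (c + j) ≡ nth δ (c + j)
  nth-widen-tail j = trans (cong (λ m → nth (widen c k δ) (m + j)) (sym (length-applyUpTo _ c)))
                           (trans (nth-++ʳ head (drop c δ) j) (nth-drop c δ j))

  widen-positive : 1 ≤ k → Positive δ → Positive (widen c k δ)
  widen-positive 1≤k pδ = ++⁺ (applyUpTo⁺₁ _ c (λ {i} _ → ≤-trans 1≤k (m≤n+m k (nth δ i)))) (drop⁺ c pδ)

  widen-decreasing : Decreasing δ → Decreasing (widen c k δ)
  widen-decreasing d = decreasing-++ head (drop c δ) (applyUpTo⁺₂ _ c (λ i → +-monoˡ-≤ k (decreasing-step d i)))
                         (decreasing-drop c δ d) junction
    where
    junction : ∀ i → i < length head → nth (drop c δ) 0 ≤ nth head i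
    junction i i<len = subst₂ _≤_ (sym (trans (nth-drop c δ 0) (cong (nth δ) (+-identityʳ c))))
                                  (sym (nth-applyUpTo _ c i i<c))
                                  (≤-trans (decreasing-mono d (<⇒≤ i<c)) (m≤m+n (nth δ i) k))
      where
      i<c : i < c
      i<c = subst (i <_) (length-applyUpTo _ c) i<len

  sum-widen : sum (widen c k δ) ≡ sum δ + c * k
  sum-widen = begin
    sum (head ++ drop c δ)                                       ≡⟨ sum-++ head (drop c δ) ⟩
    sum head + sum (drop c δ)                                    ≡⟨ cong (_+ sum (drop c δ)) (sum-applyUpTo-+ (nth δ) k c) ⟩
    sum (applyUpTo (nth δ) c) + c * k + sum (drop c δ)           ≡⟨ xy∙z≈xz∙y (sum (applyUpTo (nth δ) c)) (c * k) (sum (drop c δ)) ⟩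
    sum (applyUpTo (nth δ) c) + sum (drop c δ) + c * k           ≡⟨ cong (_+ c * k) (sum-split-at c δ) ⟩
    sum δ + c * k ∎
    where open ≡-Reasoning

≤-length-take-++ : ∀ {a} xs (ys : List ℕ) → a ≤ length xs → a ≤ length (take a xs ++ ys)
≤-length-take-++ {a} xs ys a≤len =
  subst (_≤ length (take a xs ++ ys)) (length-take-≤ a xs a≤len)
        (subst (length (take a xs) ≤_) (sym (length-++ (take a xs))) (m≤m+n _ _))

<-length-take : ∀ {i} a (xs : List ℕ) → i < length (take a xs) → i < a
<-length-take a xs i<len = <-≤-trans i<len (≤-trans (≤-reflexive (length-take a xs)) (m⊓n≤m a _))

-- insertBlock a k c xs inserts k parts equal to c after the first a parts
-- of xs (the second half of τ).
insertBlock : ℕ → ℕ → ℕ → List ℕ → List ℕ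
insertBlock a k c xs = take a xs ++ replicate k c ++ drop a xs

removeBlock : ℕ → ℕ → List ℕ → List ℕ
removeBlock a k μ = take a μ ++ drop (a + k) μ

module _ {a k c : ℕ} {xs : List ℕ} where

  private
    block : List ℕ
    block = replicate k c ++ drop a xs

  module _ (a≤len : a ≤ length xs) where

    private
      length-prefix : length (take a xs) ≡ a
      length-prefix = length-take-≤ a xs a≤len

    nth-insert-before : ∀ i → i < a → nth (insertBlock a k c xs) i ≡ nth xs i
    nth-insert-before i i<a = trans (nth-++ˡ (take a xs) block i (subst (i <_) (sym length-prefix) i<a))
                                    (nth-take a xs i i<a)

    private
      nth-insert-from : ∀ j → nth (insertBlock a k c xs) (a + j) ≡ nth block j
      nth-insert-from j = trans (cong (λ m → nth (insertBlock a k c xs) (m + j)) (sym length-prefix))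
                                (nth-++ʳ (take a xs) block j)

    nth-insert-block : ∀ j → j < k → nth (insertBlock a k c xs) (a + j) ≡ c
    nth-insert-block j j<k = trans (nth-insert-from j)
      (trans (nth-++ˡ (replicate k c) (drop a xs) j (subst (j <_) (sym (length-replicate k)) j<k))
             (nth-replicate k c j j<k))

    nth-insert-after : ∀ j → nth (insertBlock a k c xs) (a + k + j) ≡ nth xs (a + j)
    nth-insert-after j = begin
      nth (insertBlock a k c xs) (a + k + j)     ≡⟨ cong (nth (insertBlock a k c xs)) (+-assoc a k j) ⟩
      nth (insertBlock a k c xs) (a + (k + j))   ≡⟨ nth-insert-from (k + j) ⟩
      nth block (k + j)                           ≡⟨ cong (λ m → nth block (m + j)) (sym (length-replicate k)) ⟩
      nth block (length (replicate k c) + j)      ≡⟨ nth-++ʳ (replicate k c) (drop a xs) j ⟩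
      nth (drop a xs) j                           ≡⟨ nth-drop a xs j ⟩
      nth xs (a + j) ∎
      where open ≡-Reasoning

  insert-decreasing : Decreasing xs → (∀ j → j < a → c ≤ nth xs j) → nth xs a ≤ c →
                      Decreasing (insertBlock a k c xs)
  insert-decreasing d above below =
    decreasing-++ (take a xs) block (decreasing-take a xs d)
      (decreasing-++ (replicate k c) (drop a xs) (decreasing-replicate k c) (decreasing-drop a xs d) block-junction)
      prefix-junction
    where
    after-a : nth (drop a xs) 0 ≤ c
    after-a = subst (_≤ c) (sym (trans (nth-drop a xs 0) (cong (nth xs) (+-identityʳ a)))) below
    block-junction : ∀ i → i < length (replicate k c) → nth (drop a xs) 0 ≤ nth (replicate k c) i
    block-junction i i<k = subst (nth (drop a xs) 0 ≤_)
      (sym (nth-replicate k c i (subst (i <_) (length-replicate k) i<k))) after-a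
    block-head : ∀ k → nth (replicate k c ++ drop a xs) 0 ≤ c
    block-head zero = after-a
    block-head (suc k) = ≤-refl
    prefix-junction : ∀ i → i < length (take a xs) → nth block 0 ≤ nth (take a xs) i
    prefix-junction i i<len = subst (nth block 0 ≤_) (sym (nth-take a xs i i<a)) (≤-trans (block-head k) (above i i<a))
      where
      i<a : i < a
      i<a = <-length-take a xs i<len

  insert-positive : 1 ≤ c → Positive xs → Positive (insertBlock a k c xs)
  insert-positive 1≤c pxs = ++⁺ (take⁺ a pxs) (++⁺ (replicate⁺ k 1≤c) (drop⁺ a pxs))

  sum-insert : sum (insertBlock a k c xs) ≡ sum xs + k * c
  sum-insert = begin
    sum (take a xs ++ block)                               ≡⟨ sum-++ (take a xs) block ⟩
    sum (take a xs) + sum block                            ≡⟨ cong (sum (take a xs) +_) (sum-++ (replicate k c) (drop a xs)) ⟩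
    sum (take a xs) + (sum (replicate k c) + sum (drop a xs)) ≡⟨ x∙yz≈xz∙y (sum (take a xs)) _ _ ⟩
    sum (take a xs) + sum (drop a xs) + sum (replicate k c) ≡⟨ cong₂ _+_ (sym (sum-++ (take a xs) (drop a xs))) (sum-replicate k c) ⟩
    sum (take a xs ++ drop a xs) + k * c                   ≡⟨ cong (λ l → sum l + k * c) (take++drop≡id a xs) ⟩
    sum xs + k * c ∎
    where open ≡-Reasoning

module _ {a k : ℕ} {μ : List ℕ} where

  module _ (a≤len : a ≤ length μ) where

    private
      length-prefix : length (take a μ) ≡ a
      length-prefix = length-take-≤ a μ a≤len

    nth-remove-before : ∀ i → i < a → nth (removeBlock a k μ) i ≡ nth μ i
    nth-remove-before i i<a = trans (nth-++ˡ (take a μ) (drop (a + k) μ) i (subst (i <_) (sym length-prefix) i<a))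
                                    (nth-take a μ i i<a)

    nth-remove-after : ∀ j → nth (removeBlock a k μ) (a + j) ≡ nth μ (a + k + j)
    nth-remove-after j = trans (cong (λ m → nth (removeBlock a k μ) (m + j)) (sym length-prefix))
                               (trans (nth-++ʳ (take a μ) (drop (a + k) μ) j) (nth-drop (a + k) μ j))

  remove-positive : Positive μ → Positive (removeBlock a k μ)
  remove-positive pμ = ++⁺ (take⁺ a pμ) (drop⁺ (a + k) pμ)

  remove-decreasing : Decreasing μ → Decreasing (removeBlock a k μ)
  remove-decreasing d = decreasing-++ (take a μ) (drop (a + k) μ) (decreasing-take a μ d) (decreasing-drop (a + k) μ d) junction
    where
    junction : ∀ i → i < length (take a μ) → nth (drop (a + k) μ) 0 ≤ nth (take a μ) i
    junction i i<len = subst₂ _≤_ (sym (nth-drop (a + k) μ 0)) (sym (nth-take a μ i i<a))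
                         (decreasing-mono d (≤-trans (<⇒≤ i<a) (≤-trans (m≤m+n a k) (m≤m+n (a + k) 0))))
      where
      i<a : i < a
      i<a = <-length-take a μ i<len

remove-insert : ∀ {a k c xs} → a ≤ length xs → 1 ≤ c → Positive xs →
                removeBlock a k (insertBlock a k c xs) ≡ xs
remove-insert {a} {k} {c} {xs} a≤len 1≤c pxs =
  positive-ext (remove-positive {a} {k} (insert-positive {a} {k} 1≤c pxs)) pxs entries
  where
  a≤len' : a ≤ length (insertBlock a k c xs)
  a≤len' = ≤-length-take-++ xs _ a≤len
  entries : ∀ i → nth (removeBlock a k (insertBlock a k c xs)) i ≡ nth xs i
  entries i with below-or-beyond a i
  ... | inj₁ i<a = trans (nth-remove-before a≤len' i i<a) (nth-insert-before a≤len i i<a)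
  ... | inj₂ (j , refl) = trans (nth-remove-after a≤len' j) (nth-insert-after a≤len j)

insert-remove : ∀ {a k c μ} → a ≤ length μ → 1 ≤ c → Positive μ →
                (∀ j → j < k → nth μ (a + j) ≡ c) → insertBlock a k c (removeBlock a k μ) ≡ μ
insert-remove {a} {k} {c} {μ} a≤len 1≤c pμ block =
  positive-ext (insert-positive {a} {k} 1≤c (remove-positive {a} {k} pμ)) pμ entries
  where
  a≤len' : a ≤ length (removeBlock a k μ)
  a≤len' = ≤-length-take-++ μ _ a≤len
  entries : ∀ i → nth (insertBlock a k c (removeBlock a k μ)) i ≡ nth μ i
  entries i with below-or-beyond a i
  ... | inj₁ i<a = trans (nth-insert-before a≤len' i i<a) (nth-remove-before a≤len i i<a)
  ... | inj₂ (j , refl) with below-or-beyond k j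
  ...   | inj₁ j<k = trans (nth-insert-block a≤len' j j<k) (sym (block j j<k))
  ...   | inj₂ (j' , refl) = begin
    nth (insertBlock a k c (removeBlock a k μ)) (a + (k + j')) ≡⟨ cong (nth (insertBlock a k c (removeBlock a k μ))) (sym (+-assoc a k j')) ⟩
    nth (insertBlock a k c (removeBlock a k μ)) (a + k + j')   ≡⟨ nth-insert-after a≤len' j' ⟩
    nth (removeBlock a k μ) (a + j')                           ≡⟨ nth-remove-after a≤len j' ⟩
    nth μ (a + k + j')                                         ≡⟨ cong (nth μ) (+-assoc a k j') ⟩
    nth μ (a + (k + j')) ∎
    where open ≡-Reasoning

-- shave c k l subtracts k from each of the first c parts of l and discards
-- the parts that become zero (the first half of τ).
shave : ℕ → ℕ → List ℕ → List ℕ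
shave c k l = filter (1 ≤?_) (map (_∸ k) (take c l) ++ drop c l)

shave-positive : ∀ c k l → Positive (shave c k l)
shave-positive c k l = all-filter (1 ≤?_) (map (_∸ k) (take c l) ++ drop c l)

-- If the first c parts exceed the (c+1)-st by at least k, shaving keeps
-- the list decreasing and acts entrywise.
module Shave {c k : ℕ} {l : List ℕ} (d : Decreasing l) (c≤len : c ≤ length l)
             (deep : ∀ i → i < c → nth l c + k ≤ nth l i) where

  private
    shaved : List ℕ
    shaved = map (_∸ k) (take c l)

    raw : List ℕ
    raw = shaved ++ drop c l

    length-shaved : length shaved ≡ c
    length-shaved = trans (length-map (_∸ k) (take c l)) (length-take-≤ c l c≤len)

    nth-raw-head : ∀ i → i < c → nth raw i ≡ nth l i ∸ k
    nth-raw-head i i<c = trans (nth-++ˡ shaved (drop c l) i (subst (i <_) (sym length-shaved) i<c))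
                               (trans (nth-map-∸ k (take c l) i) (cong (_∸ k) (nth-take c l i i<c)))

    nth-raw-tail : ∀ j → nth raw (c + j) ≡ nth l (c + j)
    nth-raw-tail j = trans (cong (λ m → nth raw (m + j)) (sym length-shaved))
                           (trans (nth-++ʳ shaved (drop c l) j) (nth-drop c l j))

    raw-decreasing : Decreasing raw
    raw-decreasing = decreasing-++ shaved (drop c l) (map⁺ (Linked.map (∸-monoˡ-≤ k) (decreasing-take c l d)))
                       (decreasing-drop c l d) junction
      where
      junction : ∀ i → i < length shaved → nth (drop c l) 0 ≤ nth shaved i
      junction i i<len = subst₂ _≤_ (sym (trans (nth-drop c l 0) (cong (nth l) (+-identityʳ c))))
                                    (sym (trans (sym (nth-++ˡ shaved (drop c l) i i<len)) (nth-raw-head i i<c)))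
                                    (m+n≤o⇒m≤o∸n (nth l c) (deep i i<c))
        where
        i<c : i < c
        i<c = subst (i <_) length-shaved i<len

  nth-shave-head : ∀ i → i < c → nth (shave c k l) i ≡ nth l i ∸ k
  nth-shave-head i i<c = trans (nth-drop-zeros raw raw-decreasing i) (nth-raw-head i i<c)

  nth-shave-tail : ∀ j → nth (shave c k l) (c + j) ≡ nth l (c + j)
  nth-shave-tail j = trans (nth-drop-zeros raw raw-decreasing (c + j)) (nth-raw-tail j)

  shave-decreasing : Decreasing (shave c k l)
  shave-decreasing = filter⁺ (1 ≤?_) (λ p q → ≤-trans q p) raw-decreasing

  widen-shave : 1 ≤ k → Positive l → widen c k (shave c k l) ≡ l
  widen-shave 1≤k pl = positive-ext (widen-positive c k _ 1≤k (shave-positive c k l)) pl entries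
    where
    entries : ∀ i → nth (widen c k (shave c k l)) i ≡ nth l i
    entries i with below-or-beyond c i
    ... | inj₁ i<c = trans (nth-widen-head c k _ i i<c)
                           (trans (cong (_+ k) (nth-shave-head i i<c)) (m∸n+n≡m (m+n≤o⇒n≤o (nth l c) (deep i i<c))))
    ... | inj₂ (j , refl) = trans (nth-widen-tail c k _ j) (nth-shave-tail j)

maxWith-sound : ∀ Q N → 1 ≤ maxWith Q N → T (Q (maxWith Q N))
maxWith-sound Q (suc N) h with Q (suc N) in eq
... | true = subst T (sym eq) tt
... | false = maxWith-sound Q N h

maxWith-beyond : ∀ Q N j → maxWith Q N < j → j ≤ N → ¬ T (Q j)
maxWith-beyond Q zero j lt j≤N = ⊥-elim (<-irrefl refl (≤-trans lt j≤N))
maxWith-beyond Q (suc N) j lt j≤N with Q (suc N) in eq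
... | true = ⊥-elim (<-irrefl refl (≤-trans lt j≤N))
... | false with m≤n⇒m<n∨m≡n j≤N
...   | inj₁ j<1+N = maxWith-beyond Q N j lt (≤-pred j<1+N)
...   | inj₂ refl = subst T eq

maxWith-maximal : ∀ Q N j → T (Q j) → j ≤ N → j ≤ maxWith Q N
maxWith-maximal Q N j Qj j≤N with j ≤? maxWith Q N
... | yes j≤max = j≤max
... | no j≰max = ⊥-elim (maxWith-beyond Q N j (≰⇒> j≰max) j≤N Qj)

minFrom-> : ∀ Q k N → suc k ≤ minFrom Q k N
minFrom-> Q k zero = ≤-refl
minFrom-> Q k (suc N) with Q (suc k)
... | true = ≤-refl
... | false = ≤-trans (n≤1+n (suc k)) (minFrom-> Q (suc k) N)

minFrom-≤ : ∀ Q k N → minFrom Q k N ≤ suc (k + N)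
minFrom-≤ Q k zero = s≤s (≤-reflexive (sym (+-identityʳ k)))
minFrom-≤ Q k (suc N) with Q (suc k)
... | true = s≤s (m≤m+n k (suc N))
... | false = subst (minFrom Q (suc k) N ≤_) (cong suc (sym (+-suc k N))) (minFrom-≤ Q (suc k) N)

minFrom-sound : ∀ Q k N → minFrom Q k N ≤ k + N → T (Q (minFrom Q k N))
minFrom-sound Q k zero h = ⊥-elim (<-irrefl refl (≤-trans h (≤-reflexive (+-identityʳ k))))
minFrom-sound Q k (suc N) h with Q (suc k) in eq
... | true = subst T (sym eq) tt
... | false = minFrom-sound Q (suc k) N (subst (minFrom Q (suc k) N ≤_) (+-suc k N) h)

minFrom-before : ∀ Q k N j → k < j → j < minFrom Q k N → ¬ T (Q j)
minFrom-before Q k zero j k<j j<min = ⊥-elim (<-irrefl refl (≤-trans j<min k<j))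
minFrom-before Q k (suc N) j k<j j<min with Q (suc k) in eq
... | true = ⊥-elim (<-irrefl refl (≤-trans j<min k<j))
... | false with m≤n⇒m<n∨m≡n k<j
...   | inj₁ 1+k<j = minFrom-before Q (suc k) N j 1+k<j j<min
...   | inj₂ refl = subst T eq

durfee⇒ : ∀ {l} → Decreasing l → ∀ {i} → suc i ≤ durfee l → suc i ≤ nth l i
durfee⇒ {l} d {i} h = square (durfee l) refl h
  where
  square : ∀ D → durfee l ≡ D → suc i ≤ D → suc i ≤ nth l i
  square (suc D) eq (s≤s i≤D) = ≤-trans (s≤s i≤D) (≤-trans corner (decreasing-mono d i≤D))
    where
    corner : suc D ≤ nth l D
    corner = ≤ᵇ⇒≤ (suc D) (nth l D) (subst (λ m → T (m ≤ᵇ part l m)) eq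
               (maxWith-sound _ (length l) (subst (1 ≤_) (sym eq) (s≤s z≤n))))

⇒durfee : ∀ l {i} → suc i ≤ nth l i → suc i ≤ durfee l
⇒durfee l {i} h = maxWith-maximal _ (length l) (suc i) (≤⇒≤ᵇ h) (nth-inside l i (≤-trans (s≤s z≤n) h))

smallest-conjList : ∀ l → 1 ≤ nth l 0 → smallest (conjList l) ≡ conj l (nth l 0)
smallest-conjList l h with nth l 0 | h
... | suc N | _ = last (λ i → conj l (suc i)) N (λ i → conj-antitone l (n≤1+n (suc i)))
  where
  below-first : ∀ (f : ℕ → ℕ) → (∀ i → f (suc i) ≤ f i) → ∀ n → f n ≤ f 0
  below-first f step zero = ≤-refl
  below-first f step (suc n) = ≤-trans (step n) (below-first f step n)
  last : ∀ (f : ℕ → ℕ) N → (∀ i → f (suc i) ≤ f i) → smallest (applyUpTo f (suc N)) ≡ f N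
  last f zero step = refl
  last f (suc N) step = trans (cong (f 0 ⊓_) (last (λ i → f (suc i)) N (λ i → step (suc i))))
                              (m≥n⇒m⊓n≡n (below-first f step (suc N)))

applyUpTo-constant : ∀ (f : ℕ → ℕ) n c → (∀ i → i < n → f i ≡ c) → applyUpTo f n ≡ replicate n c
applyUpTo-constant f zero c h = refl
applyUpTo-constant f (suc n) c h =
  cong₂ _∷_ (h 0 z<s) (applyUpTo-constant (λ i → f (suc i)) n c (λ i i<n → h (suc i) (s≤s i<n)))

if-<ᵇ-yes : ∀ {A : Set} {m n} (x y : A) → m < n → (if m <ᵇ n then x else y) ≡ x
if-<ᵇ-yes {m = m} {n} x y m<n with m <ᵇ n in eq
... | true = refl
... | false = ⊥-elim (subst T eq (<⇒<ᵇ m<n))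

if-<ᵇ-no : ∀ {A : Set} {m n} (x y : A) → ¬ m < n → (if m <ᵇ n then x else y) ≡ y
if-<ᵇ-no {m = m} {n} x y m≮n with m <ᵇ n in eq
... | true = ⊥-elim (m≮n (<ᵇ⇒< m n (subst T (sym eq) _)))
... | false = refl

module TauParts (λs : List ℕ) (s' t : ℕ) where
  s : ℕ
  s = suc s'
  c : ℕ
  c = conj λs s
  p : ℕ
  p = maxWith (λ q → conj λs q ≡ᵇ c) (largest λs)
  k : ℕ
  k = p ∸ s + 1
  δ : List ℕ
  δ = shave c k λs
  a : ℕ
  a = minFrom (λ i → part δ i <ᵇ c) 0 (length δ)
  a' : ℕ
  a' = a ∸ 1
  μ : List ℕ
  μ = take a' δ ++ applyUpTo (λ i → conj λs (s + i)) k ++ drop a' δ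
  b : ℕ
  b = if t <ᵇ s then t else t ∸ k

-- The inverse σ of τ.  From (μ, a, b) it reads off c = μ_a and the number
-- k = μ'_c − (a − 1) of parts equal to c from position a on, removes them
-- and widens the c largest remaining parts by k; then s = δ_c + 1, and
-- t = b or b + k according as b < s or not.
restore : ℕ → ℕ → ℕ → ℕ
restore b s k = if b <ᵇ s then b else b + k

sigmaFrom : ℕ → ℕ → ℕ → List ℕ → Triple
sigmaFrom b c k δ = (widen c k δ , suc (nth δ (c ∸ 1)) , restore b (suc (nth δ (c ∸ 1))) k)

sigma : Triple → Triple
sigma (μ , a , b) = sigmaFrom b c k (removeBlock (a ∸ 1) k μ)
  where
  c : ℕ
  c = nth μ (a ∸ 1)
  k : ℕ
  k = conj μ c ∸ (a ∸ 1)

sigma-at : ∀ μ a b {c k} → nth μ (a ∸ 1) ≡ c → conj μ c ∸ (a ∸ 1) ≡ k →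
           sigma (μ , a , b) ≡ sigmaFrom b c k (removeBlock (a ∸ 1) k μ)
sigma-at μ a b refl refl = refl

module TauAnalysis (λs : List ℕ) (s' t : ℕ) (d : Decreasing λs) (pλ : Positive λs)
                   (s≤D : suc s' ≤ durfee λs) where
  open TauParts λs s' t public

  -- Since s lies in the Durfee square, c = λ'_s ≥ s.
  s≤c : s ≤ c
  s≤c = conj-galois⇐ d (s≤s z≤n) (durfee⇒ d s≤D)

  1≤c : 1 ≤ c
  1≤c = ≤-trans (s≤s z≤n) s≤c

  -- c₀ = c − 1 is the 0-based index of the c-th part.
  c₀ : ℕ
  c₀ = c ∸ 1

  c≡1+c₀ : c ≡ suc c₀
  c≡1+c₀ = sym (suc-∸1 1≤c)

  c₀<c : c₀ < c
  c₀<c = subst (c₀ <_) (sym c≡1+c₀) ≤-refl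

  private
    same-height : ℕ → Bool
    same-height q = conj λs q ≡ᵇ c

  s≤λ₁ : s ≤ largest λs
  s≤λ₁ = conj-galois⇒ d (s≤s z≤n) 1≤c

  s≤p : s ≤ p
  s≤p = maxWith-maximal same-height (largest λs) s (≡⇒≡ᵇ c c refl) s≤λ₁

  conj-p : conj λs p ≡ c
  conj-p = ≡ᵇ⇒≡ _ _ (maxWith-sound same-height (largest λs) (≤-trans (s≤s z≤n) s≤p))

  conj-after-p : conj λs (suc p) < c
  conj-after-p = ≤∧≢⇒< (subst (conj λs (suc p) ≤_) conj-p (conj-antitone λs (n≤1+n p))) shorter
    where
    shorter : conj λs (suc p) ≢ c
    shorter e = maxWith-beyond same-height (largest λs) (suc p) ≤-refl
                  (conj-galois⇒ d (s≤s z≤n) (subst (0 <_) (sym e) 1≤c)) (≡⇒≡ᵇ _ _ e)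

  -- k = p − s + 1 is the number of columns s, …, p.
  k+s'≡p : k + s' ≡ p
  k+s'≡p = trans (+-assoc (p ∸ s) 1 s') (m∸n+n≡m s≤p)

  1≤k : 1 ≤ k
  1≤k = subst (1 ≤_) (+-comm 1 (p ∸ s)) (s≤s z≤n)

  k≤p : k ≤ p
  k≤p = subst (k ≤_) k+s'≡p (m≤m+n k s')

  p∸k≡s' : p ∸ k ≡ s'
  p∸k≡s' = trans (cong (_∸ k) (sym k+s'≡p)) (m+n∸m≡n k s')

  head-≥p : ∀ i → i < c → p ≤ nth λs i
  head-≥p i i<c = conj-galois⇒ d (≤-trans (s≤s z≤n) s≤p) (subst (i <_) (sym conj-p) i<c)

  λ-c≤s' : nth λs c ≤ s'
  λ-c≤s' = ≤-pred (≰⇒> (λ s≤λc → <-irrefl refl (conj-galois⇐ d (s≤s z≤n) s≤λc)))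

  λ-c₀≡p : nth λs c₀ ≡ p
  λ-c₀≡p = ≤-antisym (≤-pred (≰⇒> taller)) (head-≥p c₀ c₀<c)
    where
    taller : ¬ suc p ≤ nth λs c₀
    taller p<λ = <⇒≱ conj-after-p (subst (_≤ conj λs (suc p)) (sym c≡1+c₀) (conj-galois⇐ d (s≤s z≤n) p<λ))

  c≤len : c ≤ length λs
  c≤len = subst (_≤ length λs) (sym c≡1+c₀)
            (nth-inside λs c₀ (≤-trans (s≤s z≤n) (≤-trans s≤p (≤-reflexive (sym λ-c₀≡p)))))

  gap : ∀ i → i < c → nth λs c + k ≤ nth λs i
  gap i i<c = ≤-trans (+-monoˡ-≤ k λ-c≤s') (subst (_≤ nth λs i) (sym (trans (+-comm s' k) k+s'≡p)) (head-≥p i i<c))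

  open Shave d c≤len gap public

  dδ : Decreasing δ
  dδ = shave-decreasing

  pδ : Positive δ
  pδ = shave-positive c k λs

  δ-c₀≡s' : nth δ c₀ ≡ s'
  δ-c₀≡s' = trans (nth-shave-head c₀ c₀<c) (trans (cong (_∸ k) λ-c₀≡p) p∸k≡s')

  widen-δ : widen c k δ ≡ λs
  widen-δ = widen-shave 1≤k pλ

  private
    drops-below-c : ℕ → Bool
    drops-below-c i = part δ i <ᵇ c

  a≡1+a' : a ≡ suc a'
  a≡1+a' = sym (suc-∸1 (minFrom-> drops-below-c 0 (length δ)))

  a'≤len : a' ≤ length δ
  a'≤len = ≤-pred (subst (_≤ suc (length δ)) a≡1+a' (minFrom-≤ drops-below-c 0 (length δ)))

  δ-a'<c : nth δ a' < c
  δ-a'<c with a ≤? length δ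
  ... | yes a≤len = <ᵇ⇒< (nth δ a') c (subst (λ m → T (part δ m <ᵇ c)) a≡1+a'
                                          (minFrom-sound drops-below-c 0 (length δ) a≤len))
  ... | no a≰len = subst (_< c) (sym (nth-beyond δ a' (≤-pred (subst (length δ <_) a≡1+a' (≰⇒> a≰len))))) 1≤c

  before-a' : ∀ j → j < a' → c ≤ nth δ j
  before-a' j j<a' = ≮⇒≥ (λ δj<c → minFrom-before drops-below-c 0 (length δ) (suc j) z<s
                           (subst (suc j <_) (sym a≡1+a') (s≤s j<a')) (<⇒<ᵇ δj<c))

  a'<c : a' < c
  a'<c = ≰⇒> (λ c≤a' → <⇒≱ (subst (_< c) (sym δ-c₀≡s') s≤c) (before-a' c₀ (<-≤-trans c₀<c c≤a')))

  -- The inserted columns s, …, p all have height c, so μ inserts k parts c.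
  μ≡insert : μ ≡ insertBlock a' k c δ
  μ≡insert = cong (λ r → take a' δ ++ r ++ drop a' δ) (applyUpTo-constant _ k c height-c)
    where
    height-c : ∀ i → i < k → conj λs (s + i) ≡ c
    height-c i i<k = ≤-antisym (conj-antitone λs (m≤m+n s i))
                       (subst (_≤ conj λs (s + i)) conj-p (conj-antitone λs s+i≤p))
      where
      s+i≤p : s + i ≤ p
      s+i≤p = subst (s + i ≤_) (trans (+-comm s' k) k+s'≡p)
                (subst (_≤ s' + k) (+-suc s' i) (+-monoʳ-≤ s' i<k))

  μ̂ : List ℕ
  μ̂ = insertBlock a' k c δ

  dμ : Decreasing μ̂
  dμ = insert-decreasing dδ before-a' (<⇒≤ δ-a'<c)

  pμ : Positive μ̂
  pμ = insert-positive {a'} {k} 1≤c pδ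

  sum-μ : sum μ̂ ≡ sum λs
  sum-μ = begin
    sum μ̂                ≡⟨ sum-insert {a'} {k} ⟩
    sum δ + k * c        ≡⟨ cong (sum δ +_) (*-comm k c) ⟩
    sum δ + c * k        ≡⟨ sym (sum-widen c k δ) ⟩
    sum (widen c k δ)    ≡⟨ cong sum widen-δ ⟩
    sum λs ∎
    where open ≡-Reasoning

  μ-a'≡c : nth μ̂ a' ≡ c
  μ-a'≡c = trans (cong (nth μ̂) (sym (+-identityʳ a'))) (nth-insert-block a'≤len 0 1≤k)

  μ-after : ∀ j → nth μ̂ (a' + k + j) ≡ nth δ (a' + j)
  μ-after = nth-insert-after a'≤len

  conj-μ-c : conj μ̂ c ≡ a' + k
  conj-μ-c = conj-exactly dμ (a' + k) 1≤c below only-below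
    where
    below : ∀ i → i < a' + k → c ≤ nth μ̂ i
    below i i<a'+k with below-or-beyond a' i
    ... | inj₁ i<a' = subst (c ≤_) (sym (nth-insert-before a'≤len i i<a')) (before-a' i i<a')
    ... | inj₂ (j , refl) = ≤-reflexive (sym (nth-insert-block a'≤len j (+-cancelˡ-< a' j k i<a'+k)))
    only-below : ∀ i → c ≤ nth μ̂ i → i < a' + k
    only-below i c≤μi with below-or-beyond (a' + k) i
    ... | inj₁ i<a'+k = i<a'+k
    ... | inj₂ (j , refl) = ⊥-elim (<⇒≱ (≤-<-trans (decreasing-mono dδ (m≤m+n a' j)) δ-a'<c)
                                          (subst (c ≤_) (μ-after j) c≤μi))

  a≤durfee : suc a' ≤ durfee μ̂
  a≤durfee = ⇒durfee μ̂ (subst (suc a' ≤_) (sym μ-a'≡c) a'<c)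

  c≤μ₁ : c ≤ nth μ̂ 0
  c≤μ₁ = subst (_≤ nth μ̂ 0) μ-a'≡c (decreasing-mono dμ z≤n)

  δ₁≤μ₁ : nth δ 0 ≤ nth μ̂ 0
  δ₁≤μ₁ with 0 <? a'
  ... | yes 0<a' = ≤-reflexive (sym (nth-insert-before a'≤len 0 0<a'))
  ... | no 0≮a' = <⇒≤ (<-≤-trans (subst (λ i → nth δ i < c) (n≤0⇒n≡0 (≮⇒≥ 0≮a')) δ-a'<c) c≤μ₁)

  module Marks (1≤t : 1 ≤ t) (t≤λ₁ : t ≤ largest λs) (notQ : s ≤ t → c ≡ conj λs t → ⊥) where

    p<t : s ≤ t → p < t
    p<t s≤t = ≰⇒> (λ t≤p → notQ s≤t (≤-antisym (subst (_≤ conj λs t) conj-p (conj-antitone λs t≤p))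
                                                 (conj-antitone λs s≤t)))

    b-low : t < s → b ≡ t
    b-low = if-<ᵇ-yes t (t ∸ k)

    b-high : ¬ t < s → b ≡ t ∸ k
    b-high = if-<ᵇ-no t (t ∸ k)

    s≤t∸k : ¬ t < s → s ≤ t ∸ k
    s≤t∸k t≮s = subst (_≤ t ∸ k) (m+n∸m≡n k s)
                  (∸-monoˡ-≤ k (subst (_≤ t) (trans (cong suc (sym k+s'≡p)) (sym (+-suc k s'))) (p<t (≮⇒≥ t≮s))))

    1≤b : 1 ≤ b
    1≤b with t <? s
    ... | yes t<s = subst (1 ≤_) (sym (b-low t<s)) 1≤t
    ... | no t≮s = subst (1 ≤_) (sym (b-high t≮s)) (≤-trans (s≤s z≤n) (s≤t∸k t≮s))

    b≤δ₁ : b ≤ nth δ 0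
    b≤δ₁ with t <? s
    ... | yes t<s = ≤-trans (subst₂ _≤_ (sym (b-low t<s)) (sym δ-c₀≡s') (≤-pred t<s)) (decreasing-mono dδ z≤n)
    ... | no t≮s = subst₂ _≤_ (sym (b-high t≮s)) (sym (nth-shave-head 0 1≤c)) (∸-monoˡ-≤ k t≤λ₁)

    b≤μ₁ : b ≤ nth μ̂ 0
    b≤μ₁ with t <? s
    ... | yes t<s = subst (_≤ nth μ̂ 0) (sym (b-low t<s)) (≤-trans (<⇒≤ (<-≤-trans t<s s≤c)) c≤μ₁)
    ... | no t≮s = ≤-trans b≤δ₁ δ₁≤μ₁

    -- The defining condition of W: if a = 1 then μ'_b > s(μ') = μ'_{μ₁} = k.
    w-condition : suc a' ≡ 1 → smallest (conjList μ̂) < conj μ̂ b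
    w-condition a≡1 = subst (_< conj μ̂ b) (sym smallest≡k) k<μ'b
      where
      a'≡0 : a' ≡ 0
      a'≡0 = suc-injective a≡1
      μ₁≡c : nth μ̂ 0 ≡ c
      μ₁≡c = subst (λ i → nth μ̂ i ≡ c) a'≡0 μ-a'≡c
      smallest≡k : smallest (conjList μ̂) ≡ k
      smallest≡k = begin
        smallest (conjList μ̂) ≡⟨ smallest-conjList μ̂ (≤-trans 1≤c c≤μ₁) ⟩
        conj μ̂ (nth μ̂ 0)      ≡⟨ cong (conj μ̂) μ₁≡c ⟩
        conj μ̂ c              ≡⟨ conj-μ-c ⟩
        a' + k                ≡⟨ cong (_+ k) a'≡0 ⟩
        k ∎
        where open ≡-Reasoning
      μ-k≡δ₁ : nth μ̂ k ≡ nth δ 0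
      μ-k≡δ₁ = begin
        nth μ̂ k            ≡⟨ cong (nth μ̂) (sym (trans (+-identityʳ (a' + k)) (cong (_+ k) a'≡0))) ⟩
        nth μ̂ (a' + k + 0) ≡⟨ μ-after 0 ⟩
        nth δ (a' + 0)     ≡⟨ cong (nth δ) (trans (+-identityʳ a') a'≡0) ⟩
        nth δ 0 ∎
        where open ≡-Reasoning
      k<μ'b : k < conj μ̂ b
      k<μ'b = conj-galois⇐ dμ 1≤b (subst (b ≤_) (sym μ-k≡δ₁) b≤δ₁)

    restore-t : restore b s k ≡ t
    restore-t with t <? s
    ... | yes t<s = trans (if-<ᵇ-yes b (b + k) (subst (_< s) (sym (b-low t<s)) t<s)) (b-low t<s)
    ... | no t≮s = begin
      restore b s k ≡⟨ if-<ᵇ-no b (b + k) (λ b<s → <⇒≱ b<s (subst (s ≤_) (sym (b-high t≮s)) (s≤t∸k t≮s))) ⟩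
      b + k         ≡⟨ cong (_+ k) (b-high t≮s) ⟩
      t ∸ k + k     ≡⟨ m∸n+n≡m (≤-trans k≤p (<⇒≤ (p<t (≮⇒≥ t≮s)))) ⟩
      t ∎
      where open ≡-Reasoning

    sigma-tau : sigma (tau (λs , s , t)) ≡ (λs , s , t)
    sigma-tau = begin
      sigma (μ , a , b)                              ≡⟨ cong₂ (λ m i → sigma (m , i , b)) μ≡insert a≡1+a' ⟩
      sigma (μ̂ , suc a' , b)                         ≡⟨ sigma-at μ̂ (suc a') b μ-a'≡c k-read-off ⟩
      sigmaFrom b c k (removeBlock a' k μ̂)           ≡⟨ cong (sigmaFrom b c k) (remove-insert a'≤len 1≤c pδ) ⟩
      sigmaFrom b c k δ                              ≡⟨ cong₂ _,_ widen-δ (cong₂ _,_ (cong suc δ-c₀≡s') marks) ⟩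
      (λs , s , t) ∎
      where
      open ≡-Reasoning
      k-read-off : conj μ̂ c ∸ a' ≡ k
      k-read-off = trans (cong (_∸ a') conj-μ-c) (m+n∸m≡n a' k)
      marks : restore b (suc (nth δ c₀)) k ≡ t
      marks = trans (cong (λ x → restore b (suc x) k) δ-c₀≡s') restore-t

module Preimage (μ : List ℕ) (a' b : ℕ) (dμ : Decreasing μ) (pμ : Positive μ)
                (a≤D : suc a' ≤ durfee μ) (1≤b : 1 ≤ b) (b≤μ₁ : b ≤ largest μ)
                (w : suc a' ≡ 1 → smallest (conjList μ) < conj μ b) where

  -- c = μ_a ≥ a, since a lies in the Durfee square of μ.
  c : ℕ
  c = nth μ a'

  a≤c : suc a' ≤ c
  a≤c = durfee⇒ dμ a≤D

  1≤c : 1 ≤ c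
  1≤c = ≤-trans (s≤s z≤n) a≤c

  c₀ : ℕ
  c₀ = c ∸ 1

  c₀<c : c₀ < c
  c₀<c = subst (c₀ <_) (suc-∸1 1≤c) ≤-refl

  -- The parts equal to c occupy the positions a, …, m = μ'_c; k of them.
  m : ℕ
  m = conj μ c

  a'<m : a' < m
  a'<m = conj-galois⇐ dμ 1≤c ≤-refl

  k : ℕ
  k = m ∸ a'

  a'+k≡m : a' + k ≡ m
  a'+k≡m = m+[n∸m]≡n (<⇒≤ a'<m)

  1≤k : 1 ≤ k
  1≤k = m<n⇒0<n∸m a'<m

  μ-m<c : nth μ m < c
  μ-m<c = ≰⇒> (λ c≤μm → <-irrefl refl (conj-galois⇐ dμ 1≤c c≤μm))

  block : ∀ j → j < k → nth μ (a' + j) ≡ c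
  block j j<k = ≤-antisym (decreasing-mono dμ (m≤m+n a' j))
                  (conj-galois⇒ dμ 1≤c (subst (a' + j <_) a'+k≡m (+-monoʳ-< a' j<k)))

  a'≤len : a' ≤ length μ
  a'≤len = <⇒≤ (nth-inside μ a' 1≤c)

  δ : List ℕ
  δ = removeBlock a' k μ

  dδ : Decreasing δ
  dδ = remove-decreasing {a'} {k} dμ

  pδ : Positive δ
  pδ = remove-positive {a'} {k} pμ

  δ-after<c : ∀ j → nth δ (a' + j) < c
  δ-after<c j = subst (_< c) (sym (nth-remove-after a'≤len j))
                  (≤-<-trans (decreasing-mono dμ (subst (_≤ a' + k + j) a'+k≡m (m≤m+n (a' + k) j))) μ-m<c)

  insert-δ : insertBlock a' k c δ ≡ μ
  insert-δ = insert-remove a'≤len 1≤c pμ block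

  s' : ℕ
  s' = nth δ c₀

  s'<c : s' < c
  s'<c = subst (λ i → nth δ i < c) (m+[n∸m]≡n a'≤c₀) (δ-after<c (c₀ ∸ a'))
    where
    a'≤c₀ : a' ≤ c₀
    a'≤c₀ = ≤-pred (subst (suc a' ≤_) (sym (suc-∸1 1≤c)) a≤c)

  δ-head-≥s' : ∀ i → i < c → s' ≤ nth δ i
  δ-head-≥s' i i<c = decreasing-mono dδ (≤-pred (subst (i <_) (sym (suc-∸1 1≤c)) i<c))

  δ-tail-≤s' : ∀ j → nth δ (c + j) ≤ s'
  δ-tail-≤s' j = decreasing-mono dδ (≤-trans (<⇒≤ c₀<c) (m≤m+n c j))

  -- b ≤ δ₁: for a > 1 this is b ≤ μ₁ = δ₁; for a = 1 it is the W condition,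
  -- since then δ₁ = μ_{m+1} and s(μ') = μ'_{μ₁} = m.
  b≤δ₁ : b ≤ nth δ 0
  b≤δ₁ with 0 <? a'
  ... | yes 0<a' = subst (b ≤_) (sym (nth-remove-before a'≤len 0 0<a')) b≤μ₁
  ... | no 0≮a' = subst (b ≤_) (sym δ₁≡μm) (conj-galois⇒ dμ 1≤b (subst (_< conj μ b) smallest≡m (w (cong suc a'≡0))))
    where
    a'≡0 : a' ≡ 0
    a'≡0 = n≤0⇒n≡0 (≮⇒≥ 0≮a')
    δ₁≡μm : nth δ 0 ≡ nth μ m
    δ₁≡μm = trans (cong (nth δ) (sym (trans (+-identityʳ a') a'≡0)))
              (trans (nth-remove-after a'≤len 0) (cong (nth μ) (trans (+-identityʳ (a' + k)) a'+k≡m)))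
    smallest≡m : smallest (conjList μ) ≡ m
    smallest≡m = trans (smallest-conjList μ (subst (λ i → 1 ≤ nth μ i) a'≡0 1≤c)) (cong (λ i → conj μ (nth μ i)) (sym a'≡0))

  λs : List ℕ
  λs = widen c k δ

  dλ : Decreasing λs
  dλ = widen-decreasing c k δ dδ

  pλ : Positive λs
  pλ = widen-positive c k δ 1≤k pδ

  sum-λ : sum λs ≡ sum μ
  sum-λ = begin
    sum λs          ≡⟨ sum-widen c k δ ⟩
    sum δ + c * k   ≡⟨ cong (sum δ +_) (*-comm c k) ⟩
    sum δ + k * c   ≡⟨ sym (sum-insert {a'} {k}) ⟩
    sum (insertBlock a' k c δ) ≡⟨ cong sum insert-δ ⟩
    sum μ ∎
    where open ≡-Reasoning

  λ-head : ∀ i → i < c → nth λs i ≡ nth δ i + k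
  λ-head = nth-widen-head c k δ

  λ-tail : ∀ j → nth λs (c + j) ≡ nth δ (c + j)
  λ-tail = nth-widen-tail c k δ

  s≤s'+k : suc s' ≤ s' + k
  s≤s'+k = subst (_≤ s' + k) (+-comm s' 1) (+-monoʳ-≤ s' 1≤k)

  conj-λ : ∀ r → s' < r → r ≤ s' + k → conj λs r ≡ c
  conj-λ r s'<r r≤s'+k = conj-exactly dλ c (≤-trans (s≤s z≤n) s'<r) below only-below
    where
    below : ∀ i → i < c → r ≤ nth λs i
    below i i<c = subst (r ≤_) (sym (λ-head i i<c)) (≤-trans r≤s'+k (+-monoˡ-≤ k (δ-head-≥s' i i<c)))
    only-below : ∀ i → r ≤ nth λs i → i < c
    only-below i r≤λi with below-or-beyond c i
    ... | inj₁ i<c = i<c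
    ... | inj₂ (j , refl) = ⊥-elim (<⇒≱ (≤-<-trans (δ-tail-≤s' j) s'<r) (subst (r ≤_) (λ-tail j) r≤λi))

  conj-λ-after : conj λs (suc (s' + k)) < c
  conj-λ-after = ≰⇒> too-tall
    where
    too-tall : ¬ c ≤ conj λs (suc (s' + k))
    too-tall c≤ = <-irrefl refl (subst (suc (s' + k) ≤_) (λ-head c₀ c₀<c)
                    (conj-galois⇒ dλ (s≤s z≤n) (<-≤-trans c₀<c c≤)))

  s≤durfee : suc s' ≤ durfee λs
  s≤durfee = ⇒durfee λs (subst (suc s' ≤_) (sym (λ-head s' s'<c))
               (subst (_≤ nth δ s' + k) (+-comm s' 1) (+-mono-≤ (δ-head-≥s' s' s'<c) 1≤k)))

  t : ℕ
  t = restore b (suc s') k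

  t-low : b < suc s' → t ≡ b
  t-low = if-<ᵇ-yes b (b + k)

  t-high : ¬ b < suc s' → t ≡ b + k
  t-high = if-<ᵇ-no b (b + k)

  1≤t : 1 ≤ t
  1≤t with b <? suc s'
  ... | yes b<s = subst (1 ≤_) (sym (t-low b<s)) 1≤b
  ... | no b≮s = subst (1 ≤_) (sym (t-high b≮s)) (≤-trans 1≤b (m≤m+n b k))

  t≤λ₁ : t ≤ largest λs
  t≤λ₁ with b <? suc s'
  ... | yes b<s = subst₂ _≤_ (sym (t-low b<s)) (sym (λ-head 0 1≤c)) (≤-trans b≤δ₁ (m≤m+n (nth δ 0) k))
  ... | no b≮s = subst₂ _≤_ (sym (t-high b≮s)) (sym (λ-head 0 1≤c)) (+-monoˡ-≤ k b≤δ₁)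

  -- (λ, s, t) ∉ Q: either t < s, or t > s' + k and so λ'_t < c = λ'_s.
  notQ : suc s' ≤ t → conj λs (suc s') ≡ conj λs t → ⊥
  notQ s≤t same with b <? suc s'
  ... | yes b<s = <⇒≱ (subst (_< suc s') (sym (t-low b<s)) b<s) s≤t
  ... | no b≮s = <-irrefl (sym same) (≤-<-trans (conj-antitone λs beyond-p)
                   (subst (conj λs (suc (s' + k)) <_) (sym (conj-λ (suc s') ≤-refl s≤s'+k)) conj-λ-after))
    where
    beyond-p : suc (s' + k) ≤ t
    beyond-p = subst (suc (s' + k) ≤_) (sym (t-high b≮s)) (+-monoˡ-≤ k (≮⇒≥ b≮s))

  -- τ(λ, s, t) = (μ, a, b): rerun the analysis of τ on (λ, s, t) and
  -- identify each of its ingredients.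
  private
    module A = TauAnalysis λs s' t dλ pλ s≤durfee
    module M = A.Marks 1≤t t≤λ₁ notQ

  c-τ : A.c ≡ c
  c-τ = conj-λ (suc s') ≤-refl s≤s'+k

  p-τ : A.p ≡ s' + k
  p-τ = ≤-antisym (≮⇒≥ p-too-big) (≮⇒≥ p-too-small)
    where
    p-too-big : ¬ s' + k < A.p
    p-too-big lt = <-irrefl (trans A.conj-p c-τ) (≤-<-trans (conj-antitone λs lt) conj-λ-after)
    p-too-small : ¬ A.p < s' + k
    p-too-small lt = <-irrefl (trans (conj-λ (suc A.p) (s≤s (≤-trans (n≤1+n s') A.s≤p)) lt) (sym c-τ)) A.conj-after-p

  k-τ : A.k ≡ k
  k-τ = +-cancelʳ-≡ s' A.k k (trans A.k+s'≡p (trans p-τ (+-comm s' k)))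

  δ-τ : A.δ ≡ δ
  δ-τ = positive-ext A.pδ pδ entries
    where
    open ≡-Reasoning
    entries : ∀ i → nth A.δ i ≡ nth δ i
    entries i with below-or-beyond c i
    ... | inj₁ i<c = begin
      nth A.δ i         ≡⟨ A.nth-shave-head i (subst (i <_) (sym c-τ) i<c) ⟩
      nth λs i ∸ A.k    ≡⟨ cong₂ _∸_ (λ-head i i<c) k-τ ⟩
      nth δ i + k ∸ k   ≡⟨ m+n∸n≡m (nth δ i) k ⟩
      nth δ i ∎
    ... | inj₂ (j , refl) = begin
      nth A.δ (c + j)   ≡⟨ cong (λ x → nth A.δ (x + j)) (sym c-τ) ⟩
      nth A.δ (A.c + j) ≡⟨ A.nth-shave-tail j ⟩
      nth λs (A.c + j)  ≡⟨ cong (λ x → nth λs (x + j)) c-τ ⟩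
      nth λs (c + j)    ≡⟨ λ-tail j ⟩
      nth δ (c + j) ∎

  a'-τ : A.a' ≡ a'
  a'-τ with <-cmp A.a' a'
  ... | tri< lt _ _ = ⊥-elim (<⇒≱ (subst₂ (λ l x → nth l A.a' < x) δ-τ c-τ A.δ-a'<c)
                        (subst (c ≤_) (sym (nth-remove-before a'≤len A.a' lt))
                          (conj-galois⇒ dμ 1≤c (<-trans lt a'<m))))
  ... | tri≈ _ eq _ = eq
  ... | tri> _ _ gt = ⊥-elim (<⇒≱ (subst (λ i → nth δ i < c) (+-identityʳ a') (δ-after<c 0))
                        (subst₂ (λ x l → x ≤ nth l a') c-τ δ-τ (A.before-a' a' gt)))

  μ-τ : A.μ ≡ μ
  μ-τ = begin
    A.μ                          ≡⟨ A.μ≡insert ⟩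
    insertBlock A.a' A.k A.c A.δ ≡⟨ cong₂ (λ x y → insertBlock x y A.c A.δ) a'-τ k-τ ⟩
    insertBlock a' k A.c A.δ     ≡⟨ cong₂ (insertBlock a' k) c-τ δ-τ ⟩
    insertBlock a' k c δ         ≡⟨ insert-δ ⟩
    μ ∎
    where open ≡-Reasoning

  b-τ : A.b ≡ b
  b-τ with b <? suc s'
  ... | yes b<s = trans (M.b-low (subst (_< suc s') (sym (t-low b<s)) b<s)) (t-low b<s)
  ... | no b≮s = trans (M.b-high t≮s) (trans (cong₂ _∸_ (t-high b≮s) k-τ) (m+n∸n≡m b k))
    where
    t≮s : ¬ t < suc s'
    t≮s t<s = b≮s (≤-<-trans (m≤m+n b k) (subst (_< suc s') (t-high b≮s) t<s))

  tau-preimage : tau (λs , suc s' , t) ≡ (μ , suc a' , b)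
  tau-preimage = cong₂ _,_ μ-τ (cong₂ _,_ (trans A.a≡1+a' (cong suc a'-τ)) b-τ)

tau-on-UminusQ : ∀ n x → UminusQ n x → W n (tau x) × sigma (tau x) ≡ x
tau-on-UminusQ n (λs , suc s' , t) (x∈U@((d , pλ , |λ|≡n) , _ , s≤D , 1≤t , t≤λ₁) , ∉Q) =
  subst₂ (λ μ a → W n (μ , a , b)) (sym μ≡insert) (sym a≡1+a')
    (((dμ , pμ , trans sum-μ |λ|≡n) , s≤s z≤n , a≤durfee , 1≤b , b≤μ₁) , w-condition) ,
  sigma-tau
  where
  open TauAnalysis λs s' t d pλ s≤D
  open Marks 1≤t t≤λ₁ (λ s≤t same → ∉Q (x∈U , s≤t , same))

tau-onto-W : ∀ n y → W n y → Σ Triple (λ x → UminusQ n x × tau x ≡ y)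
tau-onto-W n (μ , suc a' , b) (((d , pμ , |μ|≡n) , _ , a≤D , 1≤b , b≤μ₁) , w) =
  (λs , suc s' , t) ,
  (((dλ , pλ , trans sum-λ |μ|≡n) , s≤s z≤n , s≤durfee , 1≤t , t≤λ₁) , (λ q → notQ (proj₁ (proj₂ q)) (proj₂ (proj₂ q)))) ,
  tau-preimage
  where
  open Preimage μ a' b d pμ a≤D 1≤b b≤μ₁ w

theorem3p3 : (n : ℕ) → 1 ≤ n →
    ((x : Triple) → UminusQ n x → W n (tau x))
    × ((x y : Triple) → UminusQ n x → UminusQ n y → tau x ≡ tau y → x ≡ y)
    × ((y : Triple) → W n y → Σ Triple (λ x → UminusQ n x × tau x ≡ y))
theorem3p3 n _ = (λ x ux → proj₁ (tau-on-UminusQ n x ux)) , injective , tau-onto-W n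
  where
  injective : ∀ x y → UminusQ n x → UminusQ n y → tau x ≡ tau y → x ≡ y
  injective x y ux uy same = begin
    x               ≡⟨ sym (proj₂ (tau-on-UminusQ n x ux)) ⟩
    sigma (tau x)   ≡⟨ cong sigma same ⟩
    sigma (tau y)   ≡⟨ proj₂ (tau-on-UminusQ n y uy) ⟩
    y ∎
    where open ≡-Reasoning
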